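{- Let $n\ge1$, $w\in\mathfrak{S}_{n+1}$, $\sigma\in\operatorname{Sym}(n)$, $\lambda(w,\sigma)=(\lambda_1,\dots,\lambda_n)$, $j\in\{1,\dots,n\}$ and $i\in\{1,\dots,n+1\}$. Let $\ell_\sigma$ and $r_\sigma$ be the last left and last right bar positions of the entry $w_i$. Then $\lambda_j=w_i$ if $j=\ell_\sigma<r_\sigma$, and $\lambda_j=-w_i$ if $j=r_\sigma<\ell_\sigma$.
   Context: $\operatorname{Sym}(n)$ is the set of permutations of $\{1,\dots,n\}$. For $w\in\mathfrak{S}_{n+1}$ in one-line notation $w_1\cdots w_{n+1}$ and $\sigma\in\operatorname{Sym}(n)$: start with the set composition $\{w_1\}|\cdots|\{w_{n+1}\}$ of $\{1,\dots,n+1\}$, bar $j$ ($1\le j\le n$) being the separator between $w_j$ and $w_{j+1}$. For $k=1,\dots,n$, at step $k$ remove bar $\sigma(k)$, merging the two consecutive blocks $B|B'$ it separates into $B\cup B'$. Set $\lambda_k=\varepsilon\cdot\max\{\min B,\min B'\}$ with $\varepsilon=+1$ if $\min B<\min B'$ and $\varepsilon=-1$ otherwise; $\lambda(w,\sigma)=(\lambda_1,\dots,\lambda_n)$. For a position $i$, let $\ell=\max\{j<i: w_j<w_i\}$ and $r=\min\{j>i:w_j<w_i\}$. Define $\ell_\sigma=\max\{k\in\{1,\dots,n\}:\sigma(k)\in\{\ell,\dots,i-1\}\}$ (the last left bar position of $w_i$) and $r_\sigma=\max\{k\in\{1,\dots,n\}:\sigma(k)\in\{i,\dots,r-1\}\}$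 (the last right bar position of $w_i$). If the set defining $\ell$ is empty (i.e. $w_i$ is a left-to-right minimum of $w$) then $\ell_\sigma=\infty$; if the set defining $r$ is empty (i.e. $w_i$ is a right-to-left minimum) then $r_\sigma=\infty$. -}

module Defs where

open import Data.Nat using (ℕ; zero; suc; _<_; _⊓_; _⊔_; _<ᵇ_; _≤ᵇ_; _≟_)
open import Data.Bool using (Bool; true; false; if_then_else_; _∧_)
open import Data.Fin using (Fin; toℕ; fromℕ<)
open import Data.Fin.Permutation using (Permutation′; _⟨$⟩ʳ_)
open import Data.List using (List; []; _∷_; _++_; map; foldr; allFin)
open import Data.Maybe using (Maybe; just; nothing; _>>=_)
open import Data.Product using (_×_; _,_)
open import Data.Unit using (⊤)
open import Data.Empty using (⊥)
open import Data.Integer using (ℤ; +_; -_)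
open import Relation.Nullary using (yes; no)

-- Conventions: everything 1-indexed as in the paper.
-- Entries of w ∈ S_{n+1} are 1..n+1, positions are 1..n+1, bars are 1..n,
-- steps are 1..n.  A permutation of Fin m is read with  x ↦ x+1 .

-- one-line notation: w_p for 1 ≤ p ≤ n+1 (0 outside that range, never used there)
wAt : ∀ {n} → Permutation′ (suc n) → ℕ → ℕ
wAt {n} w zero = 0
wAt {n} w (suc p) with suc p Data.Nat.≤? suc n
... | yes q = suc (toℕ (w ⟨$⟩ʳ fromℕ< q))
... | no _  = 0

σAt : ∀ {n} → Permutation′ n → ℕ → ℕ
σAt {n} σ zero = 0
σAt {n} σ (suc k) with suc k Data.Nat.≤? n
... | yes q = suc (toℕ (σ ⟨$⟩ʳ fromℕ< q))
... | no _  = 0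

minB : List ℕ → ℕ
minB []       = 0
minB (x ∷ xs) = foldr _⊓_ x xs

lamVal : List ℕ → List ℕ → ℤ
lamVal B B' =
  if minB B <ᵇ minB B'
  then + (minB B ⊔ minB B')
  else - (+ (minB B ⊔ minB B'))

-- A state: the list of remaining bar labels b_1 … b_m (left to right) and the
-- list of blocks B_0 … B_m, bar b_t separating B_{t-1} and B_t.
record State : Set where
  constructor st
  field
    bars   : List ℕ
    blocks : List (List ℕ)

removeBar : ℕ → List ℕ → List (List ℕ) → List ℕ × List (List ℕ) × ℤ
removeBar b (c ∷ cs) (B ∷ B' ∷ bs) with b ≟ c
... | yes _ = cs , ((B ++ B') ∷ bs) , lamVal B B'
... | no _ with removeBar b cs (B' ∷ bs)
...   | cs' , bs' , l = (c ∷ cs') , (B ∷ bs') , l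
removeBar b cs bs = cs , bs , + 0   -- unreachable for valid inputs

runBars : List ℕ → List ℕ → List (List ℕ) → List ℤ
runBars []       cs bs = []
runBars (b ∷ os) cs bs with removeBar b cs bs
... | cs' , bs' , l = l ∷ runBars os cs' bs'

range1 : ℕ → List ℕ
range1 m = map (λ (x : Fin m) → suc (toℕ x)) (allFin m)

lambdaList : ∀ {n} → Permutation′ (suc n) → Permutation′ n → List ℤ
lambdaList {n} w σ =
  runBars (map (σAt σ) (range1 n))
          (range1 n)
          (map (λ p → wAt w p ∷ []) (range1 (suc n)))

-- 1-indexed list access (default 0 outside range)
nth : List ℤ → ℕ → ℤ
nth []       _             = + 0
nth (x ∷ xs) zero          = + 0
nth (x ∷ xs) (suc zero)    = x
nth (x ∷ xs) (suc (suc k)) = nth xs (suc k)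

lam : ∀ {n} → Permutation′ (suc n) → Permutation′ n → ℕ → ℤ
lam w σ j = nth (lambdaList w σ) j

-- Last left / right bar positions.  Maybe ℕ with nothing = ∞.

maxWhere : (ℕ → Bool) → List ℕ → Maybe ℕ
maxWhere p []       = nothing
maxWhere p (x ∷ xs) with maxWhere p xs
... | just y  = just (x ⊔ y)
... | nothing = if p x then just x else nothing

minWhere : (ℕ → Bool) → List ℕ → Maybe ℕ
minWhere p []       = nothing
minWhere p (x ∷ xs) with minWhere p xs
... | just y  = if p x then just (x ⊓ y) else just y
... | nothing = if p x then just x else nothing

inRange : ℕ → ℕ → ℕ → Bool
inRange a b x = (a ≤ᵇ x) ∧ (x ≤ᵇ b)

ellPos : ∀ {n} → Permutation′ (suc n) → ℕ → Maybe ℕ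
ellPos {n} w i = maxWhere (λ j → (j <ᵇ i) ∧ (wAt w j <ᵇ wAt w i)) (range1 (suc n))

rPos : ∀ {n} → Permutation′ (suc n) → ℕ → Maybe ℕ
rPos {n} w i = minWhere (λ j → (i <ᵇ j) ∧ (wAt w j <ᵇ wAt w i)) (range1 (suc n))

-- ℓ_σ = max{ k ∈ 1..n : σ(k) ∈ {ℓ,…,i-1} }, ∞ if w_i is a left-to-right minimum
ellSigma : ∀ {n} → Permutation′ (suc n) → Permutation′ n → ℕ → Maybe ℕ
ellSigma {n} w σ i =
  ellPos w i >>= λ l → maxWhere (λ k → inRange l (i Data.Nat.∸ 1) (σAt σ k)) (range1 n)

-- r_σ = max{ k ∈ 1..n : σ(k) ∈ {i,…,r-1} }, ∞ if w_i is a right-to-left minimum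
rSigma : ∀ {n} → Permutation′ (suc n) → Permutation′ n → ℕ → Maybe ℕ
rSigma {n} w σ i =
  rPos w i >>= λ r → maxWhere (λ k → inRange i (r Data.Nat.∸ 1) (σAt σ k)) (range1 n)

_<∞_ : Maybe ℕ → Maybe ℕ → Set
just a  <∞ just b  = a < b
just a  <∞ nothing = ⊤
nothing <∞ _       = ⊥

{-# OPTIONS --safe #-}
-- At step j the bar b = σ(j) is removed, merging the blocks between b and its neighbours p < b < q
-- among the bars still present (0 and n + 1 act as sentinel bars).  If j = ℓ_σ, every other bar in
-- [ℓ, i - 1] is already gone, so p < ℓ and i ≤ q; if moreover j < r_σ, some bar in [i, r - 1] is
-- still present, so q < r.  Hence the right block contains w_i and lies in (ℓ, r), where w_i is the
-- smallest entry, while the left block contains w_ℓ < w_i: so λ_j = + w_i.  The case j = r_σ < ℓ_σ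
-- is the mirror image and gives λ_j = - w_i.
module Submission where

open import Defs
open import Data.Nat using (ℕ; zero; suc; _≤_; _<_; _+_; _∸_; _⊓_; _<ᵇ_; _≟_; _≤?_; z≤n; s≤s)
open import Data.Nat.Properties
open import Data.Integer using (ℤ; +_; -_)
open import Data.Fin using (Fin; toℕ; fromℕ<)
open import Data.Fin.Properties using (toℕ-injective; toℕ-fromℕ<; fromℕ<-toℕ; toℕ<n)
open import Data.Fin.Permutation using (Permutation′; _⟨$⟩ʳ_; _⟨$⟩ˡ_; inverseʳ)
open import Data.List using (List; []; _∷_; _++_; map; foldr; length; allFin; tabulate)
open import Data.List.Properties using (map-++; map-tabulate; tabulate-cong; length-map; length-tabulate)
open import Data.List.Membership.Propositional using (_∈_; _∉_)
open import Data.List.Membership.Propositional.Properties using (∈-map⁺; ∈-map⁻)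
open import Data.List.Relation.Unary.Any using (here; there)
open import Data.List.Relation.Unary.All as All using ()
open import Data.List.Relation.Unary.AllPairs using (AllPairs; []; _∷_)
open import Data.Maybe using (Maybe; just; nothing; _>>=_)
open import Data.Product using (_×_; _,_; ∃; proj₁; proj₂)
open import Data.Sum using (_⊎_; inj₁; inj₂)
open import Data.Bool using (Bool; true; false; _∧_)
open import Function using (_∘_; Injection)
open import Function.Properties.Inverse using (Inverse⇒Injection)
open import Relation.Nullary using (¬_; yes; no; contradiction)
open import Relation.Nullary.Reflects using (Reflects; ofʸ; ofⁿ; _×-reflects_)
open import Relation.Binary.Definitions using (tri<; tri≈; tri>)
open import Relation.Binary.PropositionalEquality

-- Ranges and blocks of positions

upFrom : ℕ → ℕ → List ℕ
upFrom s zero    = []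
upFrom s (suc t) = s ∷ upFrom (suc s) t

∈-upFrom⁻ : ∀ {s t x} → x ∈ upFrom s t → s ≤ x × x < s + t
∈-upFrom⁻ {s} {suc t} (here refl) = ≤-refl , m<m+n s (s≤s z≤n)
∈-upFrom⁻ {s} {suc t} {x} (there x∈) =
  let s<x , x<s+t = ∈-upFrom⁻ x∈ in <⇒≤ s<x , subst (x <_) (sym (+-suc s t)) x<s+t

∈-upFrom⁺ : ∀ {s t x} → s ≤ x → x < s + t → x ∈ upFrom s t
∈-upFrom⁺ {s} {zero} {x} s≤x x<s+0 = contradiction s≤x (<⇒≱ (subst (x <_) (+-identityʳ s) x<s+0))
∈-upFrom⁺ {s} {suc t} {x} s≤x x<s+t with s ≟ x
... | yes refl = here refl
... | no s≢x   = there (∈-upFrom⁺ (≤∧≢⇒< s≤x s≢x) (subst (x <_) (+-suc s t) x<s+t))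

upFrom-++ : ∀ s x y → upFrom s x ++ upFrom (s + x) y ≡ upFrom s (x + y)
upFrom-++ s zero    y rewrite +-identityʳ s = refl
upFrom-++ s (suc x) y rewrite +-suc s x = cong (s ∷_) (upFrom-++ (suc s) x y)

upFrom-split : ∀ s {k t} → k < t → upFrom s t ≡ upFrom s k ++ s + k ∷ upFrom (suc (s + k)) (t ∸ suc k)
upFrom-split s {zero}  {suc t} _ rewrite +-identityʳ s = refl
upFrom-split s {suc k} {suc t} (s≤s k<t) rewrite +-suc s k = cong (s ∷_) (upFrom-split (suc s) k<t)

tabulate-upFrom : ∀ s m → tabulate {n = m} (λ x → s + toℕ x) ≡ upFrom s m
tabulate-upFrom s zero    = refl
tabulate-upFrom s (suc m) =
  cong₂ _∷_ (+-identityʳ s) (trans (tabulate-cong (λ x → +-suc s (toℕ x))) (tabulate-upFrom (suc s) m))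

range1≡upFrom : ∀ m → range1 m ≡ upFrom 1 m
range1≡upFrom m = trans (map-tabulate (λ x → x) (λ x → suc (toℕ x))) (tabulate-upFrom 1 m)

∈-range1⁻ : ∀ {m x} → x ∈ range1 m → 1 ≤ x × x ≤ m
∈-range1⁻ {m} x∈ = let 1≤x , x<1+m = ∈-upFrom⁻ (subst (_ ∈_) (range1≡upFrom m) x∈) in 1≤x , ≤-pred x<1+m

∈-range1⁺ : ∀ {m x} → 1 ≤ x → x ≤ m → x ∈ range1 m
∈-range1⁺ {m} 1≤x x≤m = subst (_ ∈_) (sym (range1≡upFrom m)) (∈-upFrom⁺ 1≤x (s≤s x≤m))

range1-increasing : ∀ m → AllPairs _<_ (range1 m)
range1-increasing m = subst (AllPairs _<_) (sym (range1≡upFrom m)) (upFrom-increasing 1 m)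
  where
  upFrom-increasing : ∀ s t → AllPairs _<_ (upFrom s t)
  upFrom-increasing s zero    = []
  upFrom-increasing s (suc t) = All.tabulate (proj₁ ∘ ∈-upFrom⁻) ∷ upFrom-increasing (suc s) t

range1-split : ∀ {k n} → k < n → range1 n ≡ range1 k ++ suc k ∷ upFrom (suc (suc k)) (n ∸ suc k)
range1-split {k} {n} k<n rewrite range1≡upFrom n | range1≡upFrom k = upFrom-split 1 k<n

length-range1 : ∀ m → length (range1 m) ≡ m
length-range1 m = trans (length-map (λ x → suc (toℕ x)) (allFin m)) (length-tabulate (λ x → x))

-- The entries between bar a and bar c, bar c separating positions c and c + 1.
block : (ℕ → ℕ) → ℕ → ℕ → List ℕ
block f a c = map f (upFrom (suc a) (c ∸ a))

∈-block⁺ : ∀ f {a c y} → a < y → y ≤ c → f y ∈ block f a c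
∈-block⁺ f {a} {c} {y} a<y y≤c =
  ∈-map⁺ f (∈-upFrom⁺ a<y (s≤s (subst (y ≤_) (sym (m+[n∸m]≡n (≤-trans (<⇒≤ a<y) y≤c))) y≤c)))

∈-block⁻ : ∀ f {a c z} → a ≤ c → z ∈ block f a c → ∃ λ y → a < y × y ≤ c × z ≡ f y
∈-block⁻ f {a} {c} a≤c z∈ =
  let y , y∈ , z≡fy = ∈-map⁻ f z∈
      a<y , y<1+a+[c∸a] = ∈-upFrom⁻ y∈
  in y , a<y , subst (y ≤_) (m+[n∸m]≡n a≤c) (≤-pred y<1+a+[c∸a]) , z≡fy

block-++ : ∀ f {a c d} → a ≤ c → c ≤ d → block f a c ++ block f c d ≡ block f a d
block-++ f {a} {c} {d} a≤c c≤d = begin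
    map f (upFrom (suc a) (c ∸ a)) ++ map f (upFrom (suc c) (d ∸ c))
  ≡⟨ sym (map-++ f (upFrom (suc a) (c ∸ a)) (upFrom (suc c) (d ∸ c))) ⟩
    map f (upFrom (suc a) (c ∸ a) ++ upFrom (suc c) (d ∸ c))
  ≡⟨ cong (λ s → map f (upFrom (suc a) (c ∸ a) ++ upFrom (suc s) (d ∸ c))) (sym (m+[n∸m]≡n a≤c)) ⟩
    map f (upFrom (suc a) (c ∸ a) ++ upFrom (suc a + (c ∸ a)) (d ∸ c))
  ≡⟨ cong (map f) (upFrom-++ (suc a) (c ∸ a) (d ∸ c)) ⟩
    map f (upFrom (suc a) ((c ∸ a) + (d ∸ c)))
  ≡⟨ cong (map f ∘ upFrom (suc a)) lengths ⟩
    map f (upFrom (suc a) (d ∸ a)) ∎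
  where
  open ≡-Reasoning
  lengths : (c ∸ a) + (d ∸ c) ≡ d ∸ a
  lengths = +-cancelˡ-≡ a _ _ (begin
      a + ((c ∸ a) + (d ∸ c)) ≡⟨ sym (+-assoc a _ _) ⟩
      a + (c ∸ a) + (d ∸ c)   ≡⟨ cong (_+ (d ∸ c)) (m+[n∸m]≡n a≤c) ⟩
      c + (d ∸ c)             ≡⟨ m+[n∸m]≡n c≤d ⟩
      d                       ≡⟨ sym (m+[n∸m]≡n (≤-trans a≤c c≤d)) ⟩
      a + (d ∸ a)             ∎)

block-singleton : ∀ f a → block f a (suc a) ≡ f (suc a) ∷ []
block-singleton f a = cong (map f ∘ upFrom (suc a)) (m+n∸n≡m 1 a)

foldr-⊓-≤ : ∀ x xs {y} → y ∈ x ∷ xs → foldr _⊓_ x xs ≤ y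
foldr-⊓-≤ x []       (here refl)         = ≤-refl
foldr-⊓-≤ x (z ∷ zs) (here refl)         = ≤-trans (m⊓n≤n z _) (foldr-⊓-≤ x zs (here refl))
foldr-⊓-≤ x (z ∷ zs) (there (here refl)) = m⊓n≤m z _
foldr-⊓-≤ x (z ∷ zs) (there (there y∈))  = ≤-trans (m⊓n≤n z _) (foldr-⊓-≤ x zs (there y∈))

foldr-⊓-glb : ∀ {m} x xs → m ≤ x → (∀ {z} → z ∈ xs → m ≤ z) → m ≤ foldr _⊓_ x xs
foldr-⊓-glb x []       m≤x _  = m≤x
foldr-⊓-glb x (z ∷ zs) m≤x lb = ⊓-glb (lb (here refl)) (foldr-⊓-glb x zs m≤x (lb ∘ there))

minB-≡ : ∀ {xs v} → v ∈ xs → (∀ {z} → z ∈ xs → v ≤ z) → minB xs ≡ v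
minB-≡ {x ∷ xs} v∈ lb = ≤-antisym (foldr-⊓-≤ x xs v∈) (foldr-⊓-glb x xs (lb (here refl)) (lb ∘ there))

LowerBoundOn : (ℕ → ℕ) → ℕ → ℕ → ℕ → Set
LowerBoundOn f a c v = ∀ {y} → a < y → y < c → v ≤ f y

LowerBoundOn-mono : ∀ {f a a′ c c′ v} → a ≤ a′ → c′ ≤ c → LowerBoundOn f a c v → LowerBoundOn f a′ c′ v
LowerBoundOn-mono a≤a′ c′≤c lb a′<y y<c′ = lb (≤-<-trans a≤a′ a′<y) (<-≤-trans y<c′ c′≤c)

LowerBoundOn-join : ∀ {f a i c} → LowerBoundOn f a i (f i) → LowerBoundOn f i c (f i) → LowerBoundOn f a c (f i)
LowerBoundOn-join {i = i} left right {y} a<y y<c with <-cmp y i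
... | tri< y<i _ _ = left a<y y<i
... | tri≈ _ refl _ = ≤-refl
... | tri> _ _ i<y = right i<y y<c

minB-block≡ : ∀ f {a c i} → a < i → i ≤ c → LowerBoundOn f a (suc c) (f i) → minB (block f a c) ≡ f i
minB-block≡ f {a} {c} {i} a<i i≤c lb = minB-≡ (∈-block⁺ f a<i i≤c) fi≤
  where
  fi≤ : ∀ {z} → z ∈ block f a c → f i ≤ z
  fi≤ z∈ = let y , a<y , y≤c , z≡fy = ∈-block⁻ f (<⇒≤ (<-≤-trans a<i i≤c)) z∈
           in subst (f i ≤_) (sym z≡fy) (lb a<y (s≤s y≤c))

minB-block< : ∀ f {a c y v} → a < y → y ≤ c → f y < v → minB (block f a c) < v
minB-block< f {a} {c} {y} a<y y≤c fy<v with block f a c | ∈-block⁺ f a<y y≤c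
... | x ∷ xs | fy∈ = ≤-<-trans (foldr-⊓-≤ x xs fy∈) fy<v

lamVal-pos : ∀ B B′ {v} → minB B < v → minB B′ ≡ v → lamVal B B′ ≡ + v
lamVal-pos B B′ lt refl with minB B <ᵇ minB B′ | <ᵇ-reflects-< (minB B) (minB B′)
... | true  | _       = cong +_ (m≤n⇒m⊔n≡n (<⇒≤ lt))
... | false | ofⁿ ¬lt = contradiction lt ¬lt

lamVal-neg : ∀ B B′ {v} → minB B ≡ v → minB B′ < v → lamVal B B′ ≡ - (+ v)
lamVal-neg B B′ refl lt with minB B <ᵇ minB B′ | <ᵇ-reflects-< (minB B) (minB B′)
... | true  | ofʸ gt = contradiction lt (<-asym gt)
... | false | _      = cong (λ m → - (+ m)) (m≥n⇒m⊔n≡m (<⇒≤ lt))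

-- Searching a list

record Greatest (P : ℕ → Set) (xs : List ℕ) (y : ℕ) : Set where
  field
    member   : y ∈ xs
    holds    : P y
    greatest : ∀ {x} → x ∈ xs → P x → x ≤ y

record Least (P : ℕ → Set) (xs : List ℕ) (y : ℕ) : Set where
  field
    member : y ∈ xs
    holds  : P y
    least  : ∀ {x} → x ∈ xs → P x → y ≤ x

Greatest-∷ : ∀ {P z zs y} → z ≤ y → Greatest P zs y → Greatest P (z ∷ zs) y
Greatest-∷ z≤y G = record
  { member = there member ; holds = holds
  ; greatest = λ { (here refl) _ → z≤y ; (there x∈) → greatest x∈ } }
  where open Greatest G

Least-∷ : ∀ {P z zs y} → P z → Least P zs y → Least P (z ∷ zs) (z ⊓ y)
Least-∷ {z = z} {y = y} Pz L with ⊓-sel z y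
... | inj₁ z⊓y≡z rewrite z⊓y≡z = record
  { member = here refl ; holds = Pz
  ; least = λ { (here refl) _ → ≤-refl
              ; (there x∈) Px → ≤-trans (subst (_≤ y) z⊓y≡z (m⊓n≤n z y)) (Least.least L x∈ Px) } }
... | inj₂ z⊓y≡y rewrite z⊓y≡y = record
  { member = there (Least.member L) ; holds = Least.holds L
  ; least = λ { (here refl) _ → subst (_≤ z) z⊓y≡y (m⊓n≤m z y) ; (there x∈) Px → Least.least L x∈ Px } }

module _ {P : ℕ → Set} {p : ℕ → Bool} (reflects : ∀ x → Reflects (P x) (p x)) where

  maxWhere-nothing : ∀ {xs} → maxWhere p xs ≡ nothing → ∀ {x} → x ∈ xs → ¬ P x
  maxWhere-nothing {z ∷ zs} eq x∈ with maxWhere p zs in eq′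
  maxWhere-nothing {z ∷ zs} () x∈ | just _
  maxWhere-nothing {z ∷ zs} eq x∈ | nothing with p z | reflects z
  maxWhere-nothing {z ∷ zs} () x∈          | nothing | true  | _
  maxWhere-nothing {z ∷ zs} eq (here refl) | nothing | false | ofⁿ ¬Pz = ¬Pz
  maxWhere-nothing {z ∷ zs} eq (there x∈)  | nothing | false | _       = maxWhere-nothing eq′ x∈

  -- maxWhere returns z ⊔ y without testing p z, so it finds the greatest
  -- satisfying element only on increasing lists.
  maxWhere-just : ∀ {xs y} → AllPairs _<_ xs → maxWhere p xs ≡ just y → Greatest P xs y
  maxWhere-just {z ∷ zs} (z<zs ∷ zs↑) eq with maxWhere p zs in eq′
  ... | just y′ with refl ← eq = subst (Greatest P (z ∷ zs)) (sym (m≤n⇒m⊔n≡n z≤y′)) (Greatest-∷ z≤y′ G)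
    where
    G : Greatest P zs y′
    G = maxWhere-just zs↑ eq′
    z≤y′ : z ≤ y′
    z≤y′ = <⇒≤ (All.lookup z<zs (Greatest.member G))
  ... | nothing with p z | reflects z
  ...   | true | ofʸ Pz with refl ← eq =
    record { member = here refl ; holds = Pz
           ; greatest = λ { (here refl) _ → ≤-refl ; (there x∈) Px → contradiction Px (maxWhere-nothing eq′ x∈) } }

  minWhere-nothing : ∀ {xs} → minWhere p xs ≡ nothing → ∀ {x} → x ∈ xs → ¬ P x
  minWhere-nothing {z ∷ zs} eq x∈ with minWhere p zs in eq′
  minWhere-nothing {z ∷ zs} eq x∈ | just _ with p z
  minWhere-nothing {z ∷ zs} () x∈ | just _ | true
  minWhere-nothing {z ∷ zs} () x∈ | just _ | false
  minWhere-nothing {z ∷ zs} eq x∈ | nothing with p z | reflects z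
  minWhere-nothing {z ∷ zs} () x∈          | nothing | true  | _
  minWhere-nothing {z ∷ zs} eq (here refl) | nothing | false | ofⁿ ¬Pz = ¬Pz
  minWhere-nothing {z ∷ zs} eq (there x∈)  | nothing | false | _       = minWhere-nothing eq′ x∈

  minWhere-just : ∀ {xs y} → minWhere p xs ≡ just y → Least P xs y
  minWhere-just {z ∷ zs} eq with minWhere p zs in eq′
  ... | just y′ with p z | reflects z
  ...   | true | ofʸ Pz with refl ← eq = Least-∷ Pz (minWhere-just eq′)
  ...   | false | ofⁿ ¬Pz with refl ← eq = record
    { member = there member ; holds = holds
    ; least = λ { (here refl) Pz → contradiction Pz ¬Pz ; (there x∈) Px → least x∈ Px } }
    where open Least (minWhere-just {zs} eq′)
  minWhere-just {z ∷ zs} eq | nothing with p z | reflects z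
  ...   | true | ofʸ Pz with refl ← eq = record
    { member = here refl ; holds = Pz
    ; least = λ { (here refl) _ → ≤-refl ; (there x∈) Px → contradiction Px (minWhere-nothing eq′ x∈) } }

-- The merging process

Increasing : ℕ → List ℕ → ℕ → Set
Increasing a []       e = a < e
Increasing a (c ∷ cs) e = a < c × Increasing c cs e

Increasing⇒< : ∀ {a cs e} → Increasing a cs e → a < e
Increasing⇒< {cs = []}     a<e         = a<e
Increasing⇒< {cs = c ∷ cs} (a<c , inc) = <-trans a<c (Increasing⇒< inc)

Increasing-∈ : ∀ {a cs e x} → Increasing a cs e → x ∈ cs → a < x × x < e
Increasing-∈ (a<c , inc) (here refl) = a<c , Increasing⇒< inc
Increasing-∈ (a<c , inc) (there x∈)  = let c<x , x<e = Increasing-∈ inc x∈ in <-trans a<c c<x , x<e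

Increasing-weaken : ∀ {a′ a cs e} → a′ ≤ a → Increasing a cs e → Increasing a′ cs e
Increasing-weaken {cs = []}     a′≤a a<e         = ≤-<-trans a′≤a a<e
Increasing-weaken {cs = c ∷ cs} a′≤a (a<c , inc) = ≤-<-trans a′≤a a<c , inc

Increasing-upFrom : ∀ a t → Increasing a (upFrom (suc a) t) (suc (a + t))
Increasing-upFrom a zero    = s≤s (m≤m+n a 0)
Increasing-upFrom a (suc t) = ≤-refl , subst (Increasing (suc a) _) (cong suc (sym (+-suc a t))) (Increasing-upFrom (suc a) t)

Increasing-range1 : ∀ n → Increasing 0 (range1 n) (suc n)
Increasing-range1 n = subst (λ cs → Increasing 0 cs (suc n)) (sym (range1≡upFrom n)) (Increasing-upFrom 0 n)

remove : ℕ → List ℕ → List ℕ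
remove b []       = []
remove b (c ∷ cs) with b ≟ c
... | yes _ = cs
... | no _  = c ∷ remove b cs

removeAll : List ℕ → List ℕ → List ℕ
removeAll []       cs = cs
removeAll (b ∷ bs) cs = removeAll bs (remove b cs)

Increasing-remove : ∀ {a cs e} b → Increasing a cs e → Increasing a (remove b cs) e
Increasing-remove {cs = []}     b inc         = inc
Increasing-remove {cs = c ∷ cs} b (a<c , inc) with b ≟ c
... | yes _ = Increasing-weaken (<⇒≤ a<c) inc
... | no _  = a<c , Increasing-remove b inc

Increasing-removeAll : ∀ {a cs e} bs → Increasing a cs e → Increasing a (removeAll bs cs) e
Increasing-removeAll []       inc = inc
Increasing-removeAll (b ∷ bs) inc = Increasing-removeAll bs (Increasing-remove b inc)

∈-remove⁺ : ∀ {b cs x} → x ∈ cs → x ≢ b → x ∈ remove b cs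
∈-remove⁺ {b} {c ∷ cs} x∈ x≢b with b ≟ c | x∈
... | yes refl | here refl = contradiction refl x≢b
... | yes refl | there x∈′ = x∈′
... | no _     | here refl = here refl
... | no _     | there x∈′ = there (∈-remove⁺ x∈′ x≢b)

∈-remove⁻ : ∀ {a cs e b x} → Increasing a cs e → x ∈ remove b cs → x ∈ cs × x ≢ b
∈-remove⁻ {cs = c ∷ cs} {b = b} (_ , inc) x∈ with b ≟ c
... | yes refl = there x∈ , λ { refl → <-irrefl refl (proj₁ (Increasing-∈ inc x∈)) }
... | no b≢c with x∈
...   | here refl = here refl , b≢c ∘ sym
...   | there x∈′ = let x∈cs , x≢b = ∈-remove⁻ inc x∈′ in there x∈cs , x≢b

∈-removeAll⁺ : ∀ {bs cs x} → x ∈ cs → x ∉ bs → x ∈ removeAll bs cs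
∈-removeAll⁺ {[]}     x∈ _  = x∈
∈-removeAll⁺ {b ∷ bs} x∈ x∉ = ∈-removeAll⁺ (∈-remove⁺ x∈ (x∉ ∘ here)) (x∉ ∘ there)

∈-removeAll⁻ : ∀ {a cs e x} bs → Increasing a cs e → x ∈ removeAll bs cs → x ∈ cs × x ∉ bs
∈-removeAll⁻ []       inc x∈ = x∈ , λ ()
∈-removeAll⁻ (b ∷ bs) inc x∈ =
  let x∈′ , x∉bs = ∈-removeAll⁻ bs (Increasing-remove b inc) x∈
      x∈cs , x≢b = ∈-remove⁻ inc x∈′
  in x∈cs , λ { (here x≡b) → x≢b x≡b ; (there x∈bs) → x∉bs x∈bs }

-- With remaining bars cs, the state of the process is  blocks f 0 cs (n + 1).
blocks : (ℕ → ℕ) → ℕ → List ℕ → ℕ → List (List ℕ)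
blocks f a []       e = block f a e ∷ []
blocks f a (c ∷ cs) e = block f a c ∷ blocks f c cs e

blocks-singletons : ∀ f a t →
  blocks f a (upFrom (suc a) t) (suc (a + t)) ≡ map (λ x → f x ∷ []) (upFrom (suc a) (suc t))
blocks-singletons f a zero    rewrite +-identityʳ a = cong (_∷ []) (block-singleton f a)
blocks-singletons f a (suc t) rewrite +-suc a t = cong₂ _∷_ (block-singleton f a) (blocks-singletons f (suc a) t)

stepValue : (ℕ → ℕ) → ℕ → ℕ → ℕ → List ℕ → ℤ
stepValue f a e b cs = proj₂ (proj₂ (removeBar b cs (blocks f a cs e)))

record Neighbours (a : ℕ) (cs : List ℕ) (e b p q : ℕ) : Set where
  field
    p<b   : p < b
    b<q   : b < q
    left  : p ≡ a ⊎ p ∈ cs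
    right : q ≡ e ⊎ q ∈ cs
    gapˡ  : ∀ {x} → x ∈ cs → x < b → x ≤ p
    gapʳ  : ∀ {x} → x ∈ cs → b < x → q ≤ x

record Merging (f : ℕ → ℕ) (a : ℕ) (cs : List ℕ) (e b : ℕ) (v : ℤ) : Set where
  field
    p q        : ℕ
    neighbours : Neighbours a cs e b p q
    value      : v ≡ lamVal (block f p b) (block f b q)

Neighbours-∷ : ∀ {a c cs e b p q} → Increasing c cs e → b ∈ cs →
  Neighbours c cs e b p q → Neighbours a (c ∷ cs) e b p q
Neighbours-∷ {c = c} {cs} {p = p} inc b∈ nb = record
  { p<b = p<b ; b<q = b<q
  ; left = inj₂ (left′ left)
  ; right = right′ right
  ; gapˡ = λ { (here refl) _ → c≤p left ; (there x∈) x<b → gapˡ x∈ x<b }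
  ; gapʳ = λ { (here refl) b<c → contradiction b<c (<-asym (proj₁ (Increasing-∈ inc b∈)))
             ; (there x∈) b<x → gapʳ x∈ b<x }
  }
  where
  open Neighbours nb
  left′ : p ≡ c ⊎ p ∈ cs → p ∈ c ∷ cs
  left′ (inj₁ refl) = here refl
  left′ (inj₂ p∈)   = there p∈
  right′ : ∀ {q e} → q ≡ e ⊎ q ∈ cs → q ≡ e ⊎ q ∈ c ∷ cs
  right′ (inj₁ q≡e) = inj₁ q≡e
  right′ (inj₂ q∈)  = inj₂ (there q∈)
  c≤p : p ≡ c ⊎ p ∈ cs → c ≤ p
  c≤p (inj₁ refl) = ≤-refl
  c≤p (inj₂ p∈)   = <⇒≤ (proj₁ (Increasing-∈ inc p∈))

Neighbours-q≤e : ∀ {a cs e b p q} → Increasing a cs e → Neighbours a cs e b p q → q ≤ e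
Neighbours-q≤e inc nb with Neighbours.right nb
... | inj₁ refl = ≤-refl
... | inj₂ q∈   = <⇒≤ (proj₂ (Increasing-∈ inc q∈))

Neighbours-outside : ∀ {a cs e b p q lo hi} → Neighbours a cs e b p q → a < lo → hi < e → lo ≤ b → b ≤ hi →
  (∀ {x} → x ∈ cs → lo ≤ x → x ≤ hi → x ≡ b) → p < lo × hi < q
Neighbours-outside {a} {cs} {e} {b} {p} {q} {lo} {hi} nb a<lo hi<e lo≤b b≤hi onlyB = p<lo left , hi<q right
  where
  open Neighbours nb
  p<lo : p ≡ a ⊎ p ∈ cs → p < lo
  p<lo (inj₁ refl) = a<lo
  p<lo (inj₂ p∈)   = ≰⇒> λ lo≤p → <-irrefl (onlyB p∈ lo≤p (≤-trans (<⇒≤ p<b) b≤hi)) p<b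
  hi<q : q ≡ e ⊎ q ∈ cs → hi < q
  hi<q (inj₁ refl) = hi<e
  hi<q (inj₂ q∈)   = ≰⇒> λ q≤hi → <-irrefl (sym (onlyB q∈ (≤-trans lo≤b (<⇒≤ b<q)) q≤hi)) b<q

removeBar-blocks : ∀ f b {a cs e} → Increasing a cs e →
  ∃ λ v → removeBar b cs (blocks f a cs e) ≡ (remove b cs , blocks f a (remove b cs) e , v)
removeBar-blocks f b {cs = []} _ = + 0 , refl
removeBar-blocks f b {a} {c ∷ []} {e} (a<c , c<e) with b ≟ c
... | yes refl = v , cong (λ B → [] , B ∷ [] , v) (block-++ f (<⇒≤ a<c) (<⇒≤ c<e))
  where v = lamVal (block f a c) (block f c e)
... | no _     = + 0 , refl
removeBar-blocks f b {a} {c ∷ d ∷ ds} (a<c , c<d , inc) with b ≟ c | removeBar-blocks f b {cs = d ∷ ds} (c<d , inc)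
... | yes refl | _ = v , cong (λ B → d ∷ ds , B ∷ blocks f d ds _ , v) (block-++ f (<⇒≤ a<c) (<⇒≤ c<d))
  where v = lamVal (block f a c) (block f c d)
... | no _ | v , eq rewrite eq = v , refl

removeBar-merges : ∀ f {a cs e b} → Increasing a cs e → b ∈ cs → Merging f a cs e b (stepValue f a e b cs)
removeBar-merges f {a} {c ∷ []} {e} {b} (a<c , c<e) b∈ with b ≟ c | b∈
... | yes refl | _ = record
  { p = a ; q = e ; value = refl
  ; neighbours = record
    { p<b = a<c ; b<q = c<e ; left = inj₁ refl ; right = inj₁ refl
    ; gapˡ = λ { (here refl) x<b → contradiction x<b (<-irrefl refl) }
    ; gapʳ = λ { (here refl) b<x → contradiction b<x (<-irrefl refl) } } }
... | no b≢c | here b≡c = contradiction b≡c b≢c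
removeBar-merges f {a} {c ∷ d ∷ ds} {e} {b} (a<c , c<d , inc) b∈ with b ≟ c | b∈
... | yes refl | _ = record
  { p = a ; q = d ; value = refl
  ; neighbours = record
    { p<b = a<c ; b<q = c<d ; left = inj₁ refl ; right = inj₂ (there (here refl))
    ; gapˡ = λ { (here refl) x<b → contradiction x<b (<-irrefl refl)
               ; (there x∈) x<b → contradiction x<b (<-asym (proj₁ (Increasing-∈ (c<d , inc) x∈))) }
    ; gapʳ = λ { (here refl) b<x → contradiction b<x (<-irrefl refl)
               ; (there (here refl)) _ → ≤-refl
               ; (there (there x∈)) _ → <⇒≤ (proj₁ (Increasing-∈ inc x∈)) } } }
... | no b≢c | here b≡c = contradiction b≡c b≢c
... | no _ | there b∈′ with removeBar b (d ∷ ds) (blocks f c (d ∷ ds) e) | removeBar-merges f (c<d , inc) b∈′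
...   | _ | m = record
  { p = p ; q = q ; value = value
  ; neighbours = Neighbours-∷ (c<d , inc) b∈′ neighbours }
  where open Merging m

runBars-++ : ∀ f {a cs e} → Increasing a cs e → ∀ bs {b bs′} →
  nth (runBars (bs ++ b ∷ bs′) cs (blocks f a cs e)) (suc (length bs)) ≡ stepValue f a e b (removeAll bs cs)
runBars-++ f {a} {cs} {e} inc [] {b} with removeBar b cs (blocks f a cs e)
... | _ = refl
runBars-++ f {a} {cs} {e} inc (c ∷ bs) with removeBar c cs (blocks f a cs e) | removeBar-blocks f c inc
... | _ | v , refl = runBars-++ f (Increasing-remove c inc) bs

-- Bars removed by σ

module _ {n : ℕ} (σ : Permutation′ n) where

  σAt-suc : ∀ {k} (k<n : k < n) → σAt σ (suc k) ≡ suc (toℕ (σ ⟨$⟩ʳ fromℕ< k<n))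
  σAt-suc {k} k<n with suc k ≤? n
  ... | yes _   = refl
  ... | no k≮n = contradiction k<n k≮n

  σAt-bounds : ∀ {k} → 1 ≤ k → k ≤ n → 1 ≤ σAt σ k × σAt σ k ≤ n
  σAt-bounds {suc k} _ k<n rewrite σAt-suc k<n = s≤s z≤n , toℕ<n _

  σAt-injective : ∀ {k k′} → 1 ≤ k → k ≤ n → 1 ≤ k′ → k′ ≤ n → σAt σ k ≡ σAt σ k′ → k ≡ k′
  σAt-injective {suc k} {suc k′} _ k<n _ k′<n eq rewrite σAt-suc k<n | σAt-suc k′<n =
    cong suc (begin
      k                        ≡⟨ sym (toℕ-fromℕ< k<n) ⟩
      toℕ (fromℕ< k<n)         ≡⟨ cong toℕ (σ-injective (toℕ-injective (suc-injective eq))) ⟩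
      toℕ (fromℕ< k′<n)        ≡⟨ toℕ-fromℕ< k′<n ⟩
      k′                       ∎)
    where
    open ≡-Reasoning
    open Injection (Inverse⇒Injection σ) using () renaming (injective to σ-injective)

  σAt-surjective : ∀ {c} → 1 ≤ c → c ≤ n → ∃ λ k → (1 ≤ k × k ≤ n) × σAt σ k ≡ c
  σAt-surjective {suc c} _ c<n = suc (toℕ k) , (s≤s z≤n , toℕ<n k) , (begin
      σAt σ (suc (toℕ k))                 ≡⟨ σAt-suc (toℕ<n k) ⟩
      suc (toℕ (σ ⟨$⟩ʳ fromℕ< (toℕ<n k))) ≡⟨ cong (λ x → suc (toℕ (σ ⟨$⟩ʳ x))) (fromℕ<-toℕ k (toℕ<n k)) ⟩
      suc (toℕ (σ ⟨$⟩ʳ k))                ≡⟨ cong (suc ∘ toℕ) (inverseʳ σ) ⟩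
      suc (toℕ (fromℕ< c<n))              ≡⟨ cong suc (toℕ-fromℕ< c<n) ⟩
      suc c                               ∎)
    where
    open ≡-Reasoning
    k : Fin n
    k = σ ⟨$⟩ˡ fromℕ< c<n

  liveBars : ℕ → List ℕ
  liveBars k = removeAll (map (σAt σ) (range1 k)) (range1 n)

  Increasing-liveBars : ∀ k → Increasing 0 (liveBars k) (suc n)
  Increasing-liveBars k = Increasing-removeAll (map (σAt σ) (range1 k)) (Increasing-range1 n)

  ∈-liveBars⁺ : ∀ {k k′} → k < k′ → k′ ≤ n → σAt σ k′ ∈ liveBars k
  ∈-liveBars⁺ {k} {k′} k<k′ k′≤n =
    let 1≤σk′ , σk′≤n = σAt-bounds 1≤k′ k′≤n
    in ∈-removeAll⁺ (∈-range1⁺ 1≤σk′ σk′≤n) notRemovedYet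
    where
    1≤k′ : 1 ≤ k′
    1≤k′ = ≤-trans (s≤s z≤n) k<k′
    notRemovedYet : σAt σ k′ ∉ map (σAt σ) (range1 k)
    notRemovedYet σk′∈ =
      let k″ , k″∈ , σk′≡σk″ = ∈-map⁻ (σAt σ) σk′∈
          1≤k″ , k″≤k = ∈-range1⁻ k″∈
          k′≡k″ = σAt-injective 1≤k′ k′≤n 1≤k″ (≤-trans k″≤k (<⇒≤ (<-≤-trans k<k′ k′≤n))) σk′≡σk″
      in <⇒≱ k<k′ (subst (_≤ k) (sym k′≡k″) k″≤k)

  ∈-liveBars⁻ : ∀ {k x} → x ∈ liveBars k → ∃ λ k′ → (k < k′ × k′ ≤ n) × σAt σ k′ ≡ x
  ∈-liveBars⁻ {k} {x} x∈ with ∈-removeAll⁻ (map (σAt σ) (range1 k)) (Increasing-range1 n) x∈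
  ... | x∈range , x∉removed with σAt-surjective (proj₁ (∈-range1⁻ x∈range)) (proj₂ (∈-range1⁻ x∈range))
  ... | k′ , (1≤k′ , k′≤n) , σk′≡x = k′ , (≰⇒> k′≰k , k′≤n) , σk′≡x
    where
    k′≰k : ¬ k′ ≤ k
    k′≰k k′≤k = x∉removed (subst (_∈ _) σk′≡x (∈-map⁺ (σAt σ) (∈-range1⁺ 1≤k′ k′≤k)))

  RemovesIn : ℕ → ℕ → ℕ → Set
  RemovesIn lo hi k = lo ≤ σAt σ k × σAt σ k ≤ hi

  -- ℓ_σ = lastRemoval ℓ (i - 1) and r_σ = lastRemoval i (r - 1).
  lastRemoval : ℕ → ℕ → Maybe ℕ
  lastRemoval lo hi = maxWhere (λ k → inRange lo hi (σAt σ k)) (range1 n)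

  removesIn-reflects : ∀ lo hi k → Reflects (RemovesIn lo hi k) (inRange lo hi (σAt σ k))
  removesIn-reflects lo hi k = ≤ᵇ-reflects-≤ lo (σAt σ k) ×-reflects ≤ᵇ-reflects-≤ (σAt σ k) hi

  lastRemoval-just : ∀ {lo hi k} → lastRemoval lo hi ≡ just k → Greatest (RemovesIn lo hi) (range1 n) k
  lastRemoval-just {lo} {hi} = maxWhere-just (removesIn-reflects lo hi) (range1-increasing n)

  record LastRemoval (lo hi : ℕ) : Set where
    field
      step   : ℕ
      found  : lastRemoval lo hi ≡ just step
      isLast : Greatest (RemovesIn lo hi) (range1 n) step

  lastRemoval-exists : ∀ {lo hi} → 1 ≤ lo → lo ≤ hi → hi ≤ n → LastRemoval lo hi
  lastRemoval-exists {lo} {hi} 1≤lo lo≤hi hi≤n with lastRemoval lo hi in eq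
  ... | just k  = record { step = k ; found = eq ; isLast = lastRemoval-just eq }
  ... | nothing =
    let k , (1≤k , k≤n) , σk≡hi = σAt-surjective (≤-trans 1≤lo lo≤hi) hi≤n
    in contradiction (subst (lo ≤_) (sym σk≡hi) lo≤hi , ≤-reflexive σk≡hi)
                     (maxWhere-nothing (removesIn-reflects lo hi) eq (∈-range1⁺ 1≤k k≤n))

  onlyLiveBarIn : ∀ {lo hi k x} → Greatest (RemovesIn lo hi) (range1 n) (suc k) →
    x ∈ liveBars k → lo ≤ x → x ≤ hi → x ≡ σAt σ (suc k)
  onlyLiveBarIn G x∈ lo≤x x≤hi with ∈-liveBars⁻ x∈
  ... | k′ , (k<k′ , k′≤n) , refl =
    cong (σAt σ) (≤-antisym (greatest (∈-range1⁺ (≤-trans (s≤s z≤n) k<k′) k′≤n) (lo≤x , x≤hi)) k<k′)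
    where open Greatest G

-- Nearest smaller entries

record NearestSmallerLeft (f : ℕ → ℕ) (i ℓ : ℕ) : Set where
  field
    1≤ℓ     : 1 ≤ ℓ
    ℓ<i     : ℓ < i
    smaller : f ℓ < f i
    between : LowerBoundOn f ℓ i (f i)

record NearestSmallerRight (f : ℕ → ℕ) (m i r : ℕ) : Set where
  field
    i<r     : i < r
    r≤m     : r ≤ m
    smaller : f r < f i
    between : LowerBoundOn f i r (f i)

module _ {n : ℕ} (w : Permutation′ (suc n)) {i : ℕ} where

  smallerBefore-reflects : ∀ j → Reflects (j < i × wAt w j < wAt w i) ((j <ᵇ i) ∧ (wAt w j <ᵇ wAt w i))
  smallerBefore-reflects j = <ᵇ-reflects-< j i ×-reflects <ᵇ-reflects-< (wAt w j) (wAt w i)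

  smallerAfter-reflects : ∀ j → Reflects (i < j × wAt w j < wAt w i) ((i <ᵇ j) ∧ (wAt w j <ᵇ wAt w i))
  smallerAfter-reflects j = <ᵇ-reflects-< i j ×-reflects <ᵇ-reflects-< (wAt w j) (wAt w i)

  ellPos-just : ∀ {ℓ} → i ≤ suc n → ellPos w i ≡ just ℓ → NearestSmallerLeft (wAt w) i ℓ
  ellPos-just i≤1+n eq = record
    { 1≤ℓ = proj₁ (∈-range1⁻ member) ; ℓ<i = proj₁ holds ; smaller = proj₂ holds
    ; between = λ ℓ<y y<i → ≮⇒≥ λ fy<fi →
        <⇒≱ ℓ<y (greatest (∈-range1⁺ (≤-<-trans z≤n ℓ<y) (≤-trans (<⇒≤ y<i) i≤1+n)) (y<i , fy<fi)) }
    where open Greatest (maxWhere-just smallerBefore-reflects (range1-increasing (suc n)) eq)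

  ellPos-nothing : i ≤ suc n → ellPos w i ≡ nothing → LowerBoundOn (wAt w) 0 i (wAt w i)
  ellPos-nothing i≤1+n eq 0<y y<i = ≮⇒≥ λ fy<fi →
    maxWhere-nothing smallerBefore-reflects eq (∈-range1⁺ 0<y (≤-trans (<⇒≤ y<i) i≤1+n)) (y<i , fy<fi)

  rPos-just : ∀ {r} → rPos w i ≡ just r → NearestSmallerRight (wAt w) (suc n) i r
  rPos-just eq = record
    { i<r = proj₁ holds ; r≤m = proj₂ (∈-range1⁻ member) ; smaller = proj₂ holds
    ; between = λ i<y y<r → ≮⇒≥ λ fy<fi →
        <⇒≱ y<r (least (∈-range1⁺ (≤-<-trans z≤n i<y) (≤-trans (<⇒≤ y<r) (proj₂ (∈-range1⁻ member))))
                       (i<y , fy<fi)) }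
    where open Least (minWhere-just smallerAfter-reflects {range1 (suc n)} eq)

  rPos-nothing : rPos w i ≡ nothing → LowerBoundOn (wAt w) i (suc (suc n)) (wAt w i)
  rPos-nothing eq i<y y<2+n = ≮⇒≥ λ fy<fi →
    minWhere-nothing smallerAfter-reflects eq (∈-range1⁺ (≤-<-trans z≤n i<y) (≤-pred y<2+n)) (i<y , fy<fi)

-- λ at the last left and right bar positions

>>=-just⁻ : ∀ {A B : Set} (m : Maybe A) {f : A → Maybe B} {y} →
  (m >>= f) ≡ just y → ∃ λ x → m ≡ just x × f x ≡ just y
>>=-just⁻ (just x) eq = x , refl , eq

<⇒≤∸1 : ∀ {x r} → x < r → x ≤ r ∸ 1
<⇒≤∸1 (s≤s x≤r) = x≤r

≤∸1⇒< : ∀ {x r} → 0 < r → x ≤ r ∸ 1 → x < r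
≤∸1⇒< {r = suc r} _ x≤r = s≤s x≤r

∸1<⇒≤ : ∀ {r q} → r ∸ 1 < q → r ≤ q
∸1<⇒≤ {zero}  _   = z≤n
∸1<⇒≤ {suc r} r<q = r<q

module _ {n : ℕ} (w : Permutation′ (suc n)) (σ : Permutation′ n) where

  lam≡stepValue : ∀ {k} → k < n → lam w σ (suc k) ≡ stepValue (wAt w) 0 (suc n) (σAt σ (suc k)) (liveBars σ k)
  lam≡stepValue {k} k<n = begin
      nth (runBars order (range1 n) (map (λ x → wAt w x ∷ []) (range1 (suc n)))) (suc k)
    ≡⟨ cong (λ B → nth (runBars order (range1 n) B) (suc k)) initialBlocks ⟩
      nth (runBars order (range1 n) initial) (suc k)
    ≡⟨ cong₂ (λ os d → nth (runBars os (range1 n) initial) (suc d)) orderSplit (sym lengthEarlier) ⟩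
      nth (runBars (earlier ++ σAt σ (suc k) ∷ later) (range1 n) initial) (suc (length earlier))
    ≡⟨ runBars-++ (wAt w) (Increasing-range1 n) earlier ⟩
      stepValue (wAt w) 0 (suc n) (σAt σ (suc k)) (liveBars σ k) ∎
    where
    open ≡-Reasoning
    initial : List (List ℕ)
    initial = blocks (wAt w) 0 (range1 n) (suc n)
    order earlier later : List ℕ
    order   = map (σAt σ) (range1 n)
    earlier = map (σAt σ) (range1 k)
    later   = map (σAt σ) (upFrom (suc (suc k)) (n ∸ suc k))
    initialBlocks : map (λ x → wAt w x ∷ []) (range1 (suc n)) ≡ initial
    initialBlocks = begin
      map (λ x → wAt w x ∷ []) (range1 (suc n))   ≡⟨ cong (map (λ x → wAt w x ∷ [])) (range1≡upFrom (suc n)) ⟩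
      map (λ x → wAt w x ∷ []) (upFrom 1 (suc n)) ≡⟨ sym (blocks-singletons (wAt w) 0 n) ⟩
      blocks (wAt w) 0 (upFrom 1 n) (suc n)       ≡⟨ cong (λ cs → blocks (wAt w) 0 cs (suc n)) (sym (range1≡upFrom n)) ⟩
      initial                                     ∎
    orderSplit : order ≡ earlier ++ σAt σ (suc k) ∷ later
    orderSplit = trans (cong (map (σAt σ)) (range1-split k<n)) (map-++ (σAt σ) (range1 k) _)
    lengthEarlier : length earlier ≡ k
    lengthEarlier = trans (length-map (σAt σ) (range1 k)) (length-range1 k)

  lam-merges : ∀ {k} → k < n → Merging (wAt w) 0 (liveBars σ k) (suc n) (σAt σ (suc k)) (lam w σ (suc k))
  lam-merges {k} k<n =
    subst (Merging (wAt w) 0 (liveBars σ k) (suc n) (σAt σ (suc k))) (sym (lam≡stepValue k<n))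
          (removeBar-merges (wAt w) (Increasing-liveBars σ k) (∈-liveBars⁺ σ ≤-refl k<n))

  rightNeighbour-lowerBound : ∀ {k i p q} → 1 ≤ i → Neighbours 0 (liveBars σ k) (suc n) (σAt σ (suc k)) p q →
    σAt σ (suc k) < i → just (suc k) <∞ rSigma w σ i → LowerBoundOn (wAt w) i (suc q) (wAt w i)
  rightNeighbour-lowerBound {k} {i} {q = q} 1≤i nb b<i later with rPos w i in eR
  ... | nothing = LowerBoundOn-mono ≤-refl (s≤s (Neighbours-q≤e (Increasing-liveBars σ k) nb)) (rPos-nothing w eR)
  ... | just r  = LowerBoundOn-mono ≤-refl q<r between
    where
    open NearestSmallerRight (rPos-just w eR)
    open LastRemoval (lastRemoval-exists σ 1≤i (<⇒≤∸1 i<r) (∸-monoˡ-≤ 1 r≤m))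
    open Greatest isLast
    k<step : suc k < step
    k<step = subst (just (suc k) <∞_) found later
    stepLive : σAt σ step ∈ liveBars σ k
    stepLive = ∈-liveBars⁺ σ (<⇒≤ k<step) (proj₂ (∈-range1⁻ member))
    q<r : q < r
    q<r = ≤-<-trans (Neighbours.gapʳ nb stepLive (<-≤-trans b<i (proj₁ holds))) (≤∸1⇒< (≤-<-trans z≤n i<r) (proj₂ holds))

  leftNeighbour-lowerBound : ∀ {k i p q} → i < suc n → Neighbours 0 (liveBars σ k) (suc n) (σAt σ (suc k)) p q →
    suc i ≤ σAt σ (suc k) → just (suc k) <∞ ellSigma w σ (suc i) → LowerBoundOn (wAt w) p (suc i) (wAt w (suc i))
  leftNeighbour-lowerBound {k} {i} {p} i<1+n nb i<b later with ellPos w (suc i) in eℓ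
  ... | nothing = LowerBoundOn-mono z≤n ≤-refl (ellPos-nothing w i<1+n eℓ)
  ... | just ℓ  = LowerBoundOn-mono ℓ≤p ≤-refl between
    where
    open NearestSmallerLeft (ellPos-just w i<1+n eℓ)
    open LastRemoval (lastRemoval-exists σ 1≤ℓ (≤-pred ℓ<i) (≤-pred i<1+n))
    open Greatest isLast
    k<step : suc k < step
    k<step = subst (just (suc k) <∞_) found later
    stepLive : σAt σ step ∈ liveBars σ k
    stepLive = ∈-liveBars⁺ σ (<⇒≤ k<step) (proj₂ (∈-range1⁻ member))
    ℓ≤p : ℓ ≤ p
    ℓ≤p = ≤-trans (proj₁ holds) (Neighbours.gapˡ nb stepLive (≤-trans (s≤s (proj₂ holds)) i<b))

  lam-at-lastLeftBar : ∀ {k i} → k < n → i < suc n → ellSigma w σ (suc i) ≡ just (suc k) →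
    just (suc k) <∞ rSigma w σ (suc i) → lam w σ (suc k) ≡ + wAt w (suc i)
  lam-at-lastLeftBar {k} {i} k<n i<1+n isLeft rightLater with >>=-just⁻ (ellPos w (suc i)) isLeft
  ... | ℓ , eℓ , eLast = trans value (lamVal-pos (block (wAt w) p b) (block (wAt w) b q) leftMin rightMin)
    where
    open NearestSmallerLeft (ellPos-just w i<1+n eℓ)
    open Merging (lam-merges k<n)
    b : ℕ
    b = σAt σ (suc k)
    lastLeft : Greatest (RemovesIn σ ℓ i) (range1 n) (suc k)
    lastLeft = lastRemoval-just σ eLast
    ℓ≤b : ℓ ≤ b
    ℓ≤b = proj₁ (Greatest.holds lastLeft)
    b≤i : b ≤ i
    b≤i = proj₂ (Greatest.holds lastLeft)
    p<ℓ×i<q : p < ℓ × i < q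
    p<ℓ×i<q = Neighbours-outside neighbours 1≤ℓ i<1+n ℓ≤b b≤i (onlyLiveBarIn σ lastLeft)
    rightMin : minB (block (wAt w) b q) ≡ wAt w (suc i)
    rightMin = minB-block≡ (wAt w) (s≤s b≤i) (proj₂ p<ℓ×i<q)
      (LowerBoundOn-mono ℓ≤b ≤-refl
        (LowerBoundOn-join between (rightNeighbour-lowerBound (s≤s z≤n) neighbours (s≤s b≤i) rightLater)))
    leftMin : minB (block (wAt w) p b) < wAt w (suc i)
    leftMin = minB-block< (wAt w) (proj₁ p<ℓ×i<q) ℓ≤b smaller

  lam-at-lastRightBar : ∀ {k i} → k < n → i < suc n → rSigma w σ (suc i) ≡ just (suc k) →
    just (suc k) <∞ ellSigma w σ (suc i) → lam w σ (suc k) ≡ - (+ wAt w (suc i))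
  lam-at-lastRightBar {k} {i} k<n i<1+n isRight leftLater with >>=-just⁻ (rPos w (suc i)) isRight
  ... | r , eR , eLast = trans value (lamVal-neg (block (wAt w) p b) (block (wAt w) b q) leftMin rightMin)
    where
    open NearestSmallerRight (rPos-just w eR)
    open Merging (lam-merges k<n)
    b : ℕ
    b = σAt σ (suc k)
    lastRight : Greatest (RemovesIn σ (suc i) (r ∸ 1)) (range1 n) (suc k)
    lastRight = lastRemoval-just σ eLast
    i<b : suc i ≤ b
    i<b = proj₁ (Greatest.holds lastRight)
    b≤r∸1 : b ≤ r ∸ 1
    b≤r∸1 = proj₂ (Greatest.holds lastRight)
    b<r : b < r
    b<r = ≤∸1⇒< (≤-<-trans z≤n i<r) b≤r∸1
    p≤i×r∸1<q : p < suc i × r ∸ 1 < q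
    p≤i×r∸1<q = Neighbours-outside neighbours (s≤s z≤n) (s≤s (∸-monoˡ-≤ 1 r≤m)) i<b b≤r∸1
                  (onlyLiveBarIn σ lastRight)
    leftMin : minB (block (wAt w) p b) ≡ wAt w (suc i)
    leftMin = minB-block≡ (wAt w) (proj₁ p≤i×r∸1<q) i<b
      (LowerBoundOn-mono ≤-refl b<r
        (LowerBoundOn-join (leftNeighbour-lowerBound i<1+n neighbours i<b leftLater) between))
    rightMin : minB (block (wAt w) b q) < wAt w (suc i)
    rightMin = minB-block< (wAt w) b<r (∸1<⇒≤ (proj₂ p≤i×r∸1<q)) smaller

lemma2p6 : (n : ℕ) → 1 ≤ n → (w : Permutation′ (suc n)) → (σ : Permutation′ n) →
    (j i : ℕ) → 1 ≤ j → j ≤ n → 1 ≤ i → i ≤ suc n →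
      ((ellSigma w σ i ≡ just j) × (just j <∞ rSigma w σ i) → lam w σ j ≡ + (wAt w i))
      × ((rSigma w σ i ≡ just j) × (just j <∞ ellSigma w σ i) → lam w σ j ≡ - (+ (wAt w i)))
lemma2p6 n _ w σ (suc k) (suc i) _ k<n _ i<1+n =
  (λ (isLeft , rightLater) → lam-at-lastLeftBar w σ k<n i<1+n isLeft rightLater) ,
  (λ (isRight , leftLater) → lam-at-lastRightBar w σ k<n i<1+n isRight leftLater)
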